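{- Let $V$ be a finite set with a distinguished element $e$, let $S$ be a finite set, and for each $s\in S$ let $x\mapsto x\cdot s$ be a fixed-point-free permutation of $V$ (a partial groupoid). Let $W$ be a breadth-first spanning tree of words over $S$ rooted at the empty word, identified with $V$ as described in the context, and let $*$ be the canonical extension from $W$. Then $e*y=y$ for all $y\in V$, and $*$ has right cancellation: for all $x,y,z\in V$, $x*z=y*z$ implies $x=y$.
   Context: For a word $w=t_1t_2\cdots t_k$ over $S$ and $x\in V$ write $x\cdot w=(\cdots((x\cdot t_1)\cdot t_2)\cdots)\cdot t_k$ (and $x\cdot\emptyset=x$). A breadth-first spanning tree rooted at the empty word is a set $W$ of words over $S$, closed under taking prefixes, such that the map $w\mapsto e\cdot w$ is a bijection $W\to V$ and each $w\in W$ has minimum length among all words $u$ over $S$ with $e\cdot u=e\cdot w$; each element $y\in V$ is identified with (labelled by) the unique word $w_y\in W$ with $e\cdot w_y=y$. The canonical extension $*$ is the binary operation on $V$ defined inductively along $W$: $x*y=x$ if $w_y$ is empty, and if $w_y=w_{y'}s$ with $s\in S$ (so $y'$ is the parent of $y$ in the tree $W$), then $x*y=(x*y')\cdot s$. -}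

module Defs where

open import Data.Nat using (ℕ; _≤_)
open import Data.Fin using (Fin)
open import Data.List using (List; []; _∷_; _++_; length; foldl; reverse)
open import Data.Product using (∃; _×_)
open import Relation.Binary.PropositionalEquality using (_≡_; _≢_)
open import Function.Definitions using (Bijective)

record PartialGroupoid (n m : ℕ) : Set where
  field
    e   : Fin n
    act : Fin n → Fin m → Fin n
    act-bijective : ∀ s → Bijective _≡_ _≡_ (λ x → act x s)
    act-fpf       : ∀ x s → act x s ≢ x

module _ {n m : ℕ} (G : PartialGroupoid n m) where
  open PartialGroupoid G

  actWord : Fin n → List (Fin m) → Fin n
  actWord = foldl act

  -- A breadth-first spanning tree W rooted at the empty word, given through
  -- the labelling y ↦ w_y (W is the image of label).
  record BFSTree : Set where
    field
      label : Fin n → List (Fin m)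
      label-spec : ∀ y → actWord e (label y) ≡ y
      prefix-closed : ∀ y (p q : List (Fin m)) → label y ≡ p ++ q →
                      ∃ λ y' → label y' ≡ p
      minimal : ∀ y (u : List (Fin m)) → actWord e u ≡ y →
                length (label y) ≤ length u

  -- canonical extension, computed along the path to the root:
  -- starRev x (reverse w_y) = x * y; clauses: x * y = x if w_y = [],
  -- x * y = (x * y') · s if w_y = w_{y'} s.
  starRev : Fin n → List (Fin m) → Fin n
  starRev x []      = x
  starRev x (s ∷ r) = act (starRev x r) s

  canonicalExt : BFSTree → Fin n → Fin n → Fin n
  canonicalExt T x y = starRev x (reverse (BFSTree.label T y))

-- Unwinding the recursion, x * y is x acted on by the word w_y, so e * y = e · w_y = y.
-- Right cancellation holds because x ↦ x * z is a composite of the permutations x ↦ x · s.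
module Submission where

open import Defs
open import Data.Nat using (ℕ)
open import Data.Fin using (Fin)
open import Data.List using (List; []; _∷_; reverse; _ʳ++_)
open import Data.Product using (_×_; _,_; proj₁)
open import Function.Definitions using (Injective)
open import Relation.Binary.PropositionalEquality using (_≡_; refl; trans; sym)

module _ {n m : ℕ} (G : PartialGroupoid n m) where
  open PartialGroupoid G

  actWord-starRev : ∀ x (w r : List (Fin m)) →
                    actWord G (starRev G x r) w ≡ starRev G x (w ʳ++ r)
  actWord-starRev x []      r = refl
  actWord-starRev x (s ∷ w) r = actWord-starRev x w (s ∷ r)

  starRev-reverse : ∀ x (w : List (Fin m)) → starRev G x (reverse w) ≡ actWord G x w
  starRev-reverse x w = sym (actWord-starRev x w [])

  starRev-injective : ∀ (r : List (Fin m)) → Injective _≡_ _≡_ (λ x → starRev G x r)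
  starRev-injective []      eq = eq
  starRev-injective (s ∷ r) eq = starRev-injective r (proj₁ (act-bijective s) eq)

  module _ (T : BFSTree G) where
    open BFSTree T

    canonicalExt-identityˡ : ∀ y → canonicalExt G T e y ≡ y
    canonicalExt-identityˡ y = trans (starRev-reverse e (label y)) (label-spec y)

    canonicalExt-cancelʳ : ∀ x y z → canonicalExt G T x z ≡ canonicalExt G T y z → x ≡ y
    canonicalExt-cancelʳ x y z = starRev-injective (reverse (label z))

theorem8 : (n m : ℕ) (G : PartialGroupoid n m) (T : BFSTree G) →
           ((y : Fin n) → canonicalExt G T (PartialGroupoid.e G) y ≡ y)
           × ((x y z : Fin n) → canonicalExt G T x z ≡ canonicalExt G T y z → x ≡ y)
theorem8 n m G T = canonicalExt-identityˡ G T , canonicalExt-cancelʳ G T
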